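{- Let $r>k\ge 1$ be integers and let $A\subseteq \mathbb{Z}/r\mathbb{Z}$ be nonempty and $k$-symmetric. Let $(W,R)$ be the Kripke frame with $W=\mathbb{Z}/r\mathbb{Z}$ and $R=\{(w,w+a)\mid w\in\mathbb{Z}/r\mathbb{Z},\ a\in A\}$. Then for every world $w\in\mathbb{Z}/r\mathbb{Z}$, every modal formula $\Phi$ and every valuation $V\subseteq \mathbb{Z}/r\mathbb{Z}$, with $M=(\mathbb{Z}/r\mathbb{Z},R,V)$ we have $M\vDash w:\Box\Diamond\Box\Phi$ if and only if $M\vDash w+k:\Box\Phi$.
   Context: $\mathbb{Z}/r\mathbb{Z}$ denotes the integers modulo $r$ with its usual addition; integers are identified with their residue classes. The set $A$ is called $k$-symmetric if for all $a\in A$, $k-a\in A$. Modal formulas are built from a single propositional variable $p$ by the operators $\Box,\Diamond$ (and negation $\lnot$). Kripke semantics: for a model $M=(W,R,V)$, $M\vDash w:p$ iff $w\in V$; $M\vDash w:\Box\Phi$ iff $M\vDash w':\Phi$ for all $w'$ with $(w,w')\in R$; $M\vDash w:\Diamond\Phi$ iff $M\vDash w':\Phi$ for some $w'$ with $(w,w')\in R$; $M\vDash w:\lnot\Phi$ iff $M\nvDash w:\Phi$. -}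

module Defs where

open import Data.Nat using (ℕ; zero; suc; NonZero; _∸_) renaming (_+_ to _+ℕ_)
open import Data.Nat.DivMod using (_%_; m%n<n)
open import Data.Fin using (Fin; toℕ; fromℕ<)
open import Data.Fin.Subset using (Subset; _∈_)
open import Data.Product using (Σ; ∃; _×_; _,_)
open import Relation.Nullary using (¬_)
open import Relation.Binary.PropositionalEquality using (_≡_)

module Zmod (r : ℕ) .{{_ : NonZero r}} where

  [_] : ℕ → Fin r
  [ m ] = fromℕ< (m%n<n m r)

  infixl 6 _+ᵣ_ _-ᵣ_

  _+ᵣ_ : Fin r → Fin r → Fin r
  a +ᵣ b = [ toℕ a +ℕ toℕ b ]

  _-ᵣ_ : Fin r → Fin r → Fin r
  a -ᵣ b = [ toℕ a +ℕ (r ∸ toℕ b) ]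

  Symmetric : ℕ → Subset r → Set
  Symmetric k A = ∀ a → a ∈ A → ([ k ] -ᵣ a) ∈ A

  CayleyRel : Subset r → Fin r → Fin r → Set
  CayleyRel A w w′ = Σ (Fin r) λ a → a ∈ A × w′ ≡ w +ᵣ a

data Formula : Set where
  p   : Formula
  ¬′_ : Formula → Formula
  □_  : Formula → Formula
  ◇_  : Formula → Formula

infixr 9 ¬′_ □_ ◇_

_⊨_∶_ : {W : Set} → (W → W → Set) × (W → Set) → W → Formula → Set
(R , V) ⊨ w ∶ p      = V w
(R , V) ⊨ w ∶ (¬′ Φ) = ¬ ((R , V) ⊨ w ∶ Φ)
(R , V) ⊨ w ∶ (□ Φ)  = ∀ w′ → R w w′ → (R , V) ⊨ w′ ∶ Φ
_⊨_∶_ {W} (R , V) w (◇ Φ) = Σ W λ w′ → R w w′ × ((R , V) ⊨ w′ ∶ Φ)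

infix 4 _⊨_∶_

-- Writing f w = w + k, every arrow w → w + a of the Cayley frame has a return arrow
-- w + a → f w labelled k - a ∈ A, and the arrows out of f w are exactly the images
-- under f of the arrows out of w.
module Submission where

open import Defs
open import Data.Nat using (ℕ; NonZero; _≤_; _<_; _+_; _∸_)
open import Data.Nat.Properties using (+-assoc; +-comm; m+[n∸m]≡n; <⇒≤)
open import Data.Nat.DivMod using (_%_; %-distribˡ-+; [m+n]%n≡m%n; m<n⇒m%n≡m)
open import Data.Fin using (Fin; toℕ)
open import Data.Fin.Properties using (toℕ-fromℕ<; toℕ-injective; toℕ<n)
open import Data.Fin.Subset using (Subset; _∈_; Nonempty)
open import Data.Product using (Σ; _×_; _,_)
open import Function.Bundles using (_⇔_; mk⇔)
open import Relation.Binary.PropositionalEquality hiding ([_])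

module _ {W : Set} (R : W → W → Set) (V : W → Set) (f : W → W)
         (return : ∀ u v → R u v → R v (f u))
         (shift : ∀ w v → R (f w) v → Σ W λ u → R w u × f u ≡ v) where

  □◇□⇔□∘shift : ∀ w Φ → ((R , V) ⊨ w ∶ □ ◇ □ Φ) ⇔ ((R , V) ⊨ f w ∶ □ Φ)
  □◇□⇔□∘shift w Φ = mk⇔ to from
    where
    to : (R , V) ⊨ w ∶ □ ◇ □ Φ → (R , V) ⊨ f w ∶ □ Φ
    to h v fwRv with shift w v fwRv
    ... | u , wRu , refl with h u wRu
    ... | u′ , uRu′ , □Φ = □Φ (f u) (return u u′ uRu′)

    from : (R , V) ⊨ f w ∶ □ Φ → (R , V) ⊨ w ∶ □ ◇ □ Φ
    from □Φ u wRu = f w , return w u wRu , □Φ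

module ZmodProperties (r : ℕ) .{{_ : NonZero r}} where
  open Zmod r

  toℕ-[] : ∀ m → toℕ [ m ] ≡ m % r
  toℕ-[] m = toℕ-fromℕ< _

  []-toℕ : (a : Fin r) → [ toℕ a ] ≡ a
  []-toℕ a = toℕ-injective (trans (toℕ-[] (toℕ a)) (m<n⇒m%n≡m (toℕ<n a)))

  []-cong-% : ∀ {m n} → m % r ≡ n % r → [ m ] ≡ [ n ]
  []-cong-% {m} {n} eq = toℕ-injective (trans (toℕ-[] m) (trans eq (sym (toℕ-[] n))))

  []-+ : ∀ m n → [ m ] +ᵣ [ n ] ≡ [ m + n ]
  []-+ m n = []-cong-% (begin
    (toℕ [ m ] + toℕ [ n ]) % r ≡⟨ cong₂ (λ x y → (x + y) % r) (toℕ-[] m) (toℕ-[] n) ⟩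
    (m % r + n % r) % r         ≡⟨ sym (%-distribˡ-+ m n r) ⟩
    (m + n) % r                 ∎)
    where open ≡-Reasoning

  +ᵣ-comm : ∀ a b → a +ᵣ b ≡ b +ᵣ a
  +ᵣ-comm a b = cong [_] (+-comm (toℕ a) (toℕ b))

  +ᵣ-assoc : ∀ a b c → (a +ᵣ b) +ᵣ c ≡ a +ᵣ (b +ᵣ c)
  +ᵣ-assoc a b c = begin
    (a +ᵣ b) +ᵣ c                  ≡⟨ cong ((a +ᵣ b) +ᵣ_) (sym ([]-toℕ c)) ⟩
    [ toℕ a + toℕ b ] +ᵣ [ toℕ c ] ≡⟨ []-+ _ _ ⟩
    [ toℕ a + toℕ b + toℕ c ]      ≡⟨ cong [_] (+-assoc (toℕ a) _ _) ⟩
    [ toℕ a + (toℕ b + toℕ c) ]    ≡⟨ sym ([]-+ _ _) ⟩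
    [ toℕ a ] +ᵣ (b +ᵣ c)          ≡⟨ cong (_+ᵣ (b +ᵣ c)) ([]-toℕ a) ⟩
    a +ᵣ (b +ᵣ c)                  ∎
    where open ≡-Reasoning

  +ᵣ-right-comm : ∀ a b c → (a +ᵣ b) +ᵣ c ≡ (a +ᵣ c) +ᵣ b
  +ᵣ-right-comm a b c = begin
    (a +ᵣ b) +ᵣ c ≡⟨ +ᵣ-assoc a b c ⟩
    a +ᵣ (b +ᵣ c) ≡⟨ cong (a +ᵣ_) (+ᵣ-comm b c) ⟩
    a +ᵣ (c +ᵣ b) ≡⟨ sym (+ᵣ-assoc a c b) ⟩
    (a +ᵣ c) +ᵣ b ∎
    where open ≡-Reasoning

  +ᵣ-[-ᵣ] : ∀ a b → a +ᵣ (b -ᵣ a) ≡ b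
  +ᵣ-[-ᵣ] a b = begin
    a +ᵣ (b -ᵣ a)                        ≡⟨ cong (_+ᵣ (b -ᵣ a)) (sym ([]-toℕ a)) ⟩
    [ toℕ a ] +ᵣ [ toℕ b + (r ∸ toℕ a) ] ≡⟨ []-+ _ _ ⟩
    [ toℕ a + (toℕ b + (r ∸ toℕ a)) ]    ≡⟨ cong [_] (sym (+-assoc (toℕ a) _ _)) ⟩
    [ toℕ a + toℕ b + (r ∸ toℕ a) ]      ≡⟨ cong (λ x → [ x + (r ∸ toℕ a) ]) (+-comm (toℕ a) _) ⟩
    [ toℕ b + toℕ a + (r ∸ toℕ a) ]      ≡⟨ cong [_] (+-assoc (toℕ b) _ _) ⟩
    [ toℕ b + (toℕ a + (r ∸ toℕ a)) ]    ≡⟨ cong (λ x → [ toℕ b + x ]) (m+[n∸m]≡n (<⇒≤ (toℕ<n a))) ⟩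
    [ toℕ b + r ]                        ≡⟨ []-cong-% ([m+n]%n≡m%n (toℕ b) r) ⟩
    [ toℕ b ]                            ≡⟨ []-toℕ b ⟩
    b                                    ∎
    where open ≡-Reasoning

  module _ (k : ℕ) (A : Subset r) (symmetric : Symmetric k A) where

    CayleyRel-return : ∀ u v → CayleyRel A u v → CayleyRel A v (u +ᵣ [ k ])
    CayleyRel-return u _ (a , a∈A , refl) =
      [ k ] -ᵣ a , symmetric a a∈A , sym (begin
        (u +ᵣ a) +ᵣ ([ k ] -ᵣ a) ≡⟨ +ᵣ-assoc u a _ ⟩
        u +ᵣ (a +ᵣ ([ k ] -ᵣ a)) ≡⟨ cong (u +ᵣ_) (+ᵣ-[-ᵣ] a [ k ]) ⟩
        u +ᵣ [ k ]               ∎)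
      where open ≡-Reasoning

    CayleyRel-shift : ∀ w v → CayleyRel A (w +ᵣ [ k ]) v →
                      Σ (Fin r) λ u → CayleyRel A w u × u +ᵣ [ k ] ≡ v
    CayleyRel-shift w _ (c , c∈A , refl) = w +ᵣ c , (c , c∈A , refl) , +ᵣ-right-comm w c [ k ]

theorem1 : (r k : ℕ) .{{_ : NonZero r}} → 1 ≤ k → k < r →
    (A : Subset r) → Nonempty A → Zmod.Symmetric r k A →
    (w : Fin r) (Φ : Formula) (V : Subset r) →
    ((Zmod.CayleyRel r A , (λ x → x ∈ V)) ⊨ w ∶ □ ◇ □ Φ)
    ⇔ ((Zmod.CayleyRel r A , (λ x → x ∈ V)) ⊨ Zmod._+ᵣ_ r w (Zmod.[_] r k) ∶ □ Φ)
theorem1 r k _ _ A _ symmetric w Φ V =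
  □◇□⇔□∘shift (CayleyRel A) (_∈ V) (_+ᵣ [ k ])
    (CayleyRel-return k A symmetric) (CayleyRel-shift k A symmetric) w Φ
  where
  open Zmod r
  open ZmodProperties r
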